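{- Let $D$ be a diagram with $|G(D)|=0$. If the ghost Kohnert poset $\mathcal{P}_G(D)$ is bounded, then $D$ has at most one free cell in each column, and the free cells occur in descending row order from left to right; that is, if $(r,c)$ and $(r',c')$ are free cells of $D$ with $c<c'$, then $r>r'$.
   Context: A diagram is a finite set of cells placed at positions $(r,c)\in\mathbb{Z}_{>0}\times\mathbb{Z}_{>0}$ ($r$ the row, counted from the bottom; $c$ the column), each position holding at most one cell; each cell is either an ordinary cell, written $(r,c)$, or a ghost cell, written $\langle r,c\rangle$. A position is empty if it holds no cell of either kind. $G(D)$ denotes the set of ghost cells of $D$. The ghost move at row $r$ of $D$, with result denoted $\mathcal{G}(D,r)$, is defined as follows: if row $r$ is empty, $\mathcal{G}(D,r)=D$. Otherwise let $c$ be the largest column of a cell in row $r$. If this rightmost cell is a ghost cell, or there is no empty position $(\hat r,c)$ with $\hat r<r$, or, letting $\hat r<r$ be maximal with $(\hat r,c)$ empty, there is a ghost cell $\langle r^*,c\rangle$ with $\hat r<r^*<r$, then $\mathcal{G}(D,r)=D$. Otherwise, with $\hat r<r$ maximal such that $(\hat r,c)$ is empty, $\mathcal{G}(D,r)=(D\setminus\{(r,c)\})\cup\{(\hat r,c),\langle r,c\rangle\}$. $\mathrm{GKD}(D)$ is the set of all diagrams obtainable from $D$ by finite (possibly empty) sequences of ghost moves. The ghost Kohnert poset $\mathcal{P}_G(D)$ has underlying set $\mathrm{GKD}(D)$, with $D_2\preceq D_1$ iff $D_2$ can be obtained from $D_1$ by a finite (possibly empty) sequence of ghost moves. A poset is bounded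 if it has a unique minimal element and a unique maximal element. For a diagram $D$ with no ghost cells, a free cell of $D$ is a cell $(r,c)\in D$ that is the rightmost cell of row $r$ (no $(r,\tilde c)\in D$ with $\tilde c>c$) and such that some position $(\hat r,c)$ with $\hat r<r$ is empty. -}

module Defs where

open import Data.Nat using (ℕ; zero; suc; _<_; _≤_)
open import Data.Product using (Σ; ∃; _×_; _,_)
open import Relation.Binary.PropositionalEquality using (_≡_; _≢_)
open import Relation.Nullary using (¬_)

data Cell : Set where
  empty ordinary ghost : Cell

-- A diagram: positions (r , c) with r = row (from the bottom), c = column.
-- Only positions with r ≥ 1 and c ≥ 1 may hold cells; finitely many cells.
record Diagram : Set where
  field
    cell   : ℕ → ℕ → Cell
    row0   : ∀ c → cell 0 c ≡ empty
    col0   : ∀ r → cell r 0 ≡ empty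
    finite : ∃ λ N → ∀ r c → cell r c ≢ empty → r < N × c < N
open Diagram public

_≈D_ : Diagram → Diagram → Set
D ≈D E = ∀ r c → cell D r c ≡ cell E r c

-- A non-trivial ghost move at row r: E = 𝒢(D, r) ≠ D.
-- (r , c) is the rightmost cell of row r and is ordinary; r̂ < r (r̂ ≥ 1) is the
-- maximal row with (r̂ , c) empty; no ghost cell ⟨r* , c⟩ with r̂ < r* < r;
-- E = (D ∖ {(r,c)}) ∪ {(r̂,c), ⟨r,c⟩}.
record GhostMove (D : Diagram) (r : ℕ) (E : Diagram) : Set where
  field
    c          : ℕ
    r̂          : ℕ
    isOrd      : cell D r c ≡ ordinary
    rightmost  : ∀ c' → c < c' → cell D r c' ≡ empty
    r̂pos       : 1 ≤ r̂
    r̂<r        : r̂ < r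
    r̂empty     : cell D r̂ c ≡ empty
    r̂maximal   : ∀ r' → r̂ < r' → r' < r → cell D r' c ≢ empty
    noGhost    : ∀ r* → r̂ < r* → r* < r → cell D r* c ≢ ghost
    newGhost   : cell E r c ≡ ghost
    newOrd     : cell E r̂ c ≡ ordinary
    unchanged  : ∀ r' c' → ¬ (r' ≡ r × c' ≡ c) → ¬ (r' ≡ r̂ × c' ≡ c)
                 → cell E r' c' ≡ cell D r' c'

-- E obtainable from D by a finite (possibly empty) sequence of ghost moves.
-- Moves that leave D unchanged (𝒢(D,r) = D) are absorbed by the empty sequence.
data Reach (D : Diagram) : Diagram → Set where
  here : ∀ {E} → D ≈D E → Reach D E
  step : ∀ {F E} r → GhostMove D r F → Reach F E → Reach D E

GKD : Diagram → Diagram → Set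
GKD D E = Reach D E

_≼_ : Diagram → Diagram → Set
D₂ ≼ D₁ = Reach D₁ D₂

IsMinimal : Diagram → Diagram → Set
IsMinimal D m = GKD D m × (∀ x → GKD D x → x ≼ m → x ≈D m)

IsMaximal : Diagram → Diagram → Set
IsMaximal D m = GKD D m × (∀ x → GKD D x → m ≼ x → x ≈D m)

Bounded : Diagram → Set
Bounded D =
  (∃ λ m → IsMinimal D m × (∀ m' → IsMinimal D m' → m' ≈D m)) ×
  (∃ λ M → IsMaximal D M × (∀ M' → IsMaximal D M' → M' ≈D M))

NoGhosts : Diagram → Set
NoGhosts D = ∀ r c → cell D r c ≢ ghost

FreeCell : Diagram → ℕ → ℕ → Set
FreeCell D r c =
  cell D r c ≡ ordinary ×
  (∀ c' → c < c' → cell D r c' ≡ empty) ×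
  (∃ λ r̂ → 1 ≤ r̂ × r̂ < r × cell D r̂ c ≡ empty)

module Submission where

-- Ghost cells are permanent, and so are certain other configurations. A ghost move fills an
-- empty position, so every diagram of GKD(D) lies above one admitting no move, which is
-- minimal; if 𝒫_G(D) is bounded, a configuration surviving all ghost moves that occurs
-- somewhere in GKD(D) therefore occurs in its unique minimum.
--
-- Let (a, ca) and (b, cb) be free cells with a < b and ca ≤ cb, no ghosts in rows ≤ b, and
-- let h be the row that (b, cb) moves down to. If h = a, then ca < cb: moving (a, ca) leaves
-- a ghost at (a, ca), whereas moving (b, cb) fills (a, cb), after which (a, ca) is never
-- rightmost in its row and never becomes a ghost. If h < a and ca = cb, moving (a, ca)
-- leaves a ghost that (b, ca) can never move past, whereas moving (b, ca) leaves a ghost at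
-- (b, ca). Either way the minimum is contradictory. If h < a and ca < cb, the empty position
-- (a, cb) contradicts the choice of h. If a < h, induct on b at row h: after moving (b, cb)
-- the cell (h, cb) is free, unless row h has a cell right of cb, and then its rightmost cell
-- is free already.

open import Defs
open import Data.Nat using (ℕ; zero; suc; _+_; _<_; _≤_; z≤n; s≤s; _<?_; _≤?_; _≟_)
open import Data.Nat.Properties
open import Data.Nat.Induction using (<-wellFounded; <-rec)
open import Data.Product using (_×_; _,_; ∃; ∃-syntax; proj₁; proj₂; map₁)
open import Data.Sum using (_⊎_; inj₁; inj₂)
open import Data.Empty using (⊥; ⊥-elim)
open import Function using (_∘_)
open import Induction.WellFounded using (Acc; acc)
open import Relation.Binary using (Tri; tri<; tri≈; tri>)
open import Relation.Binary.PropositionalEquality using (_≡_; _≢_; refl; sym; trans; subst; subst₂)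
open import Relation.Nullary using (¬_; Dec; yes; no)
open import Relation.Nullary.Decidable using (_×-dec_; _→-dec_; ¬?)

_≟ᶜ_ : (a b : Cell) → Dec (a ≡ b)
empty    ≟ᶜ empty    = yes refl
empty    ≟ᶜ ordinary = no λ ()
empty    ≟ᶜ ghost    = no λ ()
ordinary ≟ᶜ empty    = no λ ()
ordinary ≟ᶜ ordinary = yes refl
ordinary ≟ᶜ ghost    = no λ ()
ghost    ≟ᶜ empty    = no λ ()
ghost    ≟ᶜ ordinary = no λ ()
ghost    ≟ᶜ ghost    = yes refl

ordinary≢empty : ordinary ≢ empty
ordinary≢empty ()

ordinary≢ghost : ordinary ≢ ghost
ordinary≢ghost ()

ghost≢empty : ghost ≢ empty
ghost≢empty ()

≢empty∧≢ghost⇒≡ordinary : ∀ {a} → a ≢ empty → a ≢ ghost → a ≡ ordinary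
≢empty∧≢ghost⇒≡ordinary {empty}    a≢empty _ = ⊥-elim (a≢empty refl)
≢empty∧≢ghost⇒≡ordinary {ordinary} _       _ = refl
≢empty∧≢ghost⇒≡ordinary {ghost}    _ a≢ghost = ⊥-elim (a≢ghost refl)

<-suc-elim : {Q : ℕ → Set} {n : ℕ} →
  (∀ {i} → i < n → Q i) → Q n → ∀ {i} → i < suc n → Q i
<-suc-elim below at i<1+n with m<1+n⇒m<n∨m≡n i<1+n
... | inj₁ i<n  = below i<n
... | inj₂ refl = at

record Greatest (P : ℕ → Set) (n : ℕ) : Set where
  field
    index   : ℕ
    index<n : index < n
    holds   : P index
    maximal : ∀ {i} → index < i → i < n → ¬ P i

greatest? : {P : ℕ → Set} → (∀ i → Dec (P i)) → ∀ n →
  (∀ {i} → i < n → ¬ P i) ⊎ Greatest P n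
greatest? P? zero = inj₁ λ ()
greatest? P? (suc n) with P? n | greatest? P? n
... | yes Pn | _ = inj₂ record
  { index = n ; index<n = ≤-refl ; holds = Pn
  ; maximal = λ n<i i<1+n _ → <⇒≱ n<i (≤-pred i<1+n) }
... | no ¬Pn | inj₁ none = inj₁ (<-suc-elim none ¬Pn)
... | no ¬Pn | inj₂ g = inj₂ record
  { index = index ; index<n = m≤n⇒m≤1+n index<n ; holds = holds
  ; maximal = maximal′ }
  where
  open Greatest g
  maximal′ : ∀ {i} → index < i → i < suc n → ¬ _
  maximal′ index<i i<1+n with m<1+n⇒m<n∨m≡n i<1+n
  ... | inj₁ i<n  = maximal index<i i<n
  ... | inj₂ refl = ¬Pn

∑< : ℕ → (ℕ → ℕ) → ℕ
∑< zero    f = 0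
∑< (suc n) f = f n + ∑< n f

∑<-mono-≤ : ∀ {f g} n → (∀ i → f i ≤ g i) → ∑< n f ≤ ∑< n g
∑<-mono-≤ zero    f≤g = z≤n
∑<-mono-≤ (suc n) f≤g = +-mono-≤ (f≤g n) (∑<-mono-≤ n f≤g)

∑<-mono-< : ∀ {f g j} n → (∀ i → f i ≤ g i) → j < n → f j < g j → ∑< n f < ∑< n g
∑<-mono-< {j = j} (suc n) f≤g j<1+n fj<gj with m<1+n⇒m<n∨m≡n j<1+n
... | inj₁ j<n  = +-mono-≤-< (f≤g n) (∑<-mono-< n f≤g j<n fj<gj)
... | inj₂ refl = +-mono-<-≤ fj<gj (∑<-mono-≤ n f≤g)

≈D-refl : ∀ {D} → D ≈D D
≈D-refl _ _ = refl

GhostMove-respˡ : ∀ {D D' r F} → D ≈D D' → GhostMove D' r F → GhostMove D r F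
GhostMove-respˡ D≈D' g = record
  { c = c ; r̂ = r̂ ; r̂pos = r̂pos ; r̂<r = r̂<r
  ; isOrd     = trans (D≈D' _ c) isOrd
  ; rightmost = λ c' c<c' → trans (D≈D' _ c') (rightmost c' c<c')
  ; r̂empty    = trans (D≈D' r̂ c) r̂empty
  ; r̂maximal  = λ r' r̂<r' r'<r e → r̂maximal r' r̂<r' r'<r (trans (sym (D≈D' r' c)) e)
  ; noGhost   = λ r* r̂<r* r*<r e → noGhost r* r̂<r* r*<r (trans (sym (D≈D' r* c)) e)
  ; newGhost  = newGhost ; newOrd = newOrd
  ; unchanged = λ r' c' p q → trans (unchanged r' c' p q) (sym (D≈D' r' c')) }
  where open GhostMove g

Reach-respˡ : ∀ {D D' E} → D ≈D D' → Reach D' E → Reach D E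
Reach-respˡ D≈D' (here D'≈E)   = here λ r c → trans (D≈D' r c) (D'≈E r c)
Reach-respˡ D≈D' (step r g F↠E) = step r (GhostMove-respˡ D≈D' g) F↠E

Reach-trans : ∀ {D E F} → Reach D E → Reach E F → Reach D F
Reach-trans (here D≈E)      E↠F = Reach-respˡ D≈E E↠F
Reach-trans (step r g D'↠E) E↠F = step r g (Reach-trans D'↠E E↠F)

GKD-step : ∀ {D x r y} → GKD D x → GhostMove x r y → GKD D y
GKD-step {r = r} {y} D↠x g = Reach-trans D↠x (step r g (here (≈D-refl {y})))

module _ {y R F} (g : GhostMove y R F) where
  open GhostMove g

  unchanged-row : ∀ {p} q → p ≢ R → p ≢ r̂ → cell F p q ≡ cell y p q
  unchanged-row q p≢R p≢r̂ = unchanged _ q (p≢R ∘ proj₁) (p≢r̂ ∘ proj₁)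

  unchanged-below : ∀ {p} q → p < r̂ → cell F p q ≡ cell y p q
  unchanged-below q p<r̂ = unchanged-row q (<⇒≢ (<-trans p<r̂ r̂<r)) (<⇒≢ p<r̂)

  unchanged-column : ∀ p {q} → q ≢ c → cell F p q ≡ cell y p q
  unchanged-column p q≢c = unchanged p _ (q≢c ∘ proj₂) (q≢c ∘ proj₂)

  unchanged-above : ∀ {p} q → R < p → cell F p q ≡ cell y p q
  unchanged-above q R<p = unchanged-row q (>⇒≢ R<p) (>⇒≢ (<-trans r̂<r R<p))

  data CellChange (p q : ℕ) : Set where
    vacated   : p ≡ R → q ≡ c → CellChange p q
    filled    : p ≡ r̂ → q ≡ c → CellChange p q
    untouched : cell F p q ≡ cell y p q → CellChange p q

  cellChange : ∀ p q → CellChange p q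
  cellChange p q with p ≟ R | p ≟ r̂ | q ≟ c
  ... | yes p≡R | _       | yes q≡c = vacated p≡R q≡c
  ... | _       | yes p≡r̂ | yes q≡c = filled p≡r̂ q≡c
  ... | no p≢R  | no p≢r̂  | _       = untouched (unchanged-row q p≢R p≢r̂)
  ... | _       | _       | no q≢c  = untouched (unchanged-column p q≢c)

  nonEmpty-stable : ∀ {p q} → cell y p q ≢ empty → cell F p q ≢ empty
  nonEmpty-stable {p} {q} ne with cellChange p q
  ... | vacated refl refl = ghost≢empty ∘ trans (sym newGhost)
  ... | filled refl refl  = ⊥-elim (ne r̂empty)
  ... | untouched e       = ne ∘ trans (sym e)

Bounds : Diagram → ℕ → Set
Bounds x N = ∀ r c → cell x r c ≢ empty → r < N × c < N

RowEmptyRightOf : Diagram → ℕ → ℕ → Set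
RowEmptyRightOf x r c = ∀ c' → c < c' → cell x r c' ≡ empty

EmptyBelow : Diagram → ℕ → ℕ → Set
EmptyBelow x r c = ∃ λ e → 1 ≤ e × e < r × cell x e c ≡ empty

ordinary-bounded : ∀ x {N r c} → Bounds x N → cell x r c ≡ ordinary → r < N × c < N
ordinary-bounded x {r = r} {c} bnd isOrd = bnd r c (ordinary≢empty ∘ trans (sym isOrd))

rowEmptyRightOf-bounded : ∀ x {N} r c → Bounds x N →
  (∀ {c'} → c' < N → c < c' → cell x r c' ≢ empty → ⊥) → RowEmptyRightOf x r c
rowEmptyRightOf-bounded x r c bnd none c' c<c' with cell x r c' ≟ᶜ empty
... | yes e  = e
... | no ne = ⊥-elim (none (proj₂ (bnd r c' ne)) c<c' ne)

highestEmptyBelow : ∀ {x r c} → EmptyBelow x r c → Greatest (λ i → 1 ≤ i × cell x i c ≡ empty) r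
highestEmptyBelow {x} {r} {c} (e , 1≤e , e<r , e-empty)
  with greatest? (λ i → 1 ≤? i ×-dec cell x i c ≟ᶜ empty) r
... | inj₁ none = ⊥-elim (none e<r (1≤e , e-empty))
... | inj₂ h    = h

lastCellRightOf : ∀ x r c → RowEmptyRightOf x r c ⊎
  ∃[ c' ] (c < c' × cell x r c' ≢ empty × RowEmptyRightOf x r c')
lastCellRightOf x r c with finite x
... | N , bnd with greatest? (λ i → c <? i ×-dec ¬? (cell x r i ≟ᶜ empty)) N
... | inj₁ none = inj₁ (rowEmptyRightOf-bounded x r c bnd λ c'<N c<c' ne → none c'<N (c<c' , ne))
... | inj₂ g    = inj₂ (index , proj₁ holds , proj₂ holds ,
                        rowEmptyRightOf-bounded x r index bnd λ c'<N j<c' ne →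
                          maximal j<c' c'<N (<-trans (proj₁ holds) j<c' , ne))
  where open Greatest g

record MoveSite (x : Diagram) (R : ℕ) : Set where
  field
    c r̂       : ℕ
    isOrd     : cell x R c ≡ ordinary
    rightmost : RowEmptyRightOf x R c
    r̂pos      : 1 ≤ r̂
    r̂<r       : r̂ < R
    r̂empty    : cell x r̂ c ≡ empty
    r̂maximal  : ∀ r' → r̂ < r' → r' < R → cell x r' c ≢ empty
    noGhost   : ∀ r* → r̂ < r* → r* < R → cell x r* c ≢ ghost

siteOf : ∀ {x R F} → GhostMove x R F → MoveSite x R
siteOf g = record { GhostMove g }

module _ {x R} (s : MoveSite x R) where
  open MoveSite s

  movedCell : ℕ → ℕ → Cell
  movedCell p q with (p ≟ R ×-dec q ≟ c) | (p ≟ r̂ ×-dec q ≟ c)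
  ... | yes _ | _     = ghost
  ... | no _  | yes _ = ordinary
  ... | no _  | no _  = cell x p q

  private
    c≢0 : c ≢ 0
    c≢0 refl = ordinary≢empty (trans (sym isOrd) (col0 x R))

  movedCell-bounded : ∀ {N} → Bounds x N → ∀ p q → movedCell p q ≢ empty → p < N × q < N
  movedCell-bounded bnd p q ne with (p ≟ R ×-dec q ≟ c) | (p ≟ r̂ ×-dec q ≟ c)
  ... | yes (refl , refl) | _                 = ordinary-bounded x bnd isOrd
  ... | no _              | yes (refl , refl) = map₁ (<-trans r̂<r) (ordinary-bounded x bnd isOrd)
  ... | no _              | no _              = bnd p q ne

  afterMove : Diagram
  afterMove = record
    { cell = movedCell ; row0 = movedCell-row0 ; col0 = movedCell-col0
    ; finite = proj₁ (finite x) , movedCell-bounded (proj₂ (finite x)) }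
    where
    movedCell-row0 : ∀ q → movedCell 0 q ≡ empty
    movedCell-row0 q with (0 ≟ R ×-dec q ≟ c) | (0 ≟ r̂ ×-dec q ≟ c)
    ... | yes (0≡R , _) | _              = ⊥-elim (n≮0 (subst (r̂ <_) (sym 0≡R) r̂<r))
    ... | no _          | yes (0≡r̂ , _)  = ⊥-elim (<⇒≢ r̂pos 0≡r̂)
    ... | no _          | no _           = row0 x q
    movedCell-col0 : ∀ p → movedCell p 0 ≡ empty
    movedCell-col0 p with (p ≟ R ×-dec 0 ≟ c) | (p ≟ r̂ ×-dec 0 ≟ c)
    ... | yes (_ , 0≡c) | _              = ⊥-elim (c≢0 (sym 0≡c))
    ... | no _          | yes (_ , 0≡c)  = ⊥-elim (c≢0 (sym 0≡c))
    ... | no _          | no _           = col0 x p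

  movedCell-source : movedCell R c ≡ ghost
  movedCell-source with (R ≟ R ×-dec c ≟ c) | (R ≟ r̂ ×-dec c ≟ c)
  ... | yes _ | _ = refl
  ... | no ¬p | _ = ⊥-elim (¬p (refl , refl))

  movedCell-target : movedCell r̂ c ≡ ordinary
  movedCell-target with (r̂ ≟ R ×-dec c ≟ c) | (r̂ ≟ r̂ ×-dec c ≟ c)
  ... | yes (r̂≡R , _) | _     = ⊥-elim (<⇒≢ r̂<r r̂≡R)
  ... | no _          | yes _ = refl
  ... | no _          | no ¬p = ⊥-elim (¬p (refl , refl))

  movedCell-elsewhere : ∀ p q → ¬ (p ≡ R × q ≡ c) → ¬ (p ≡ r̂ × q ≡ c) →
    movedCell p q ≡ cell x p q
  movedCell-elsewhere p q ¬source ¬target with (p ≟ R ×-dec q ≟ c) | (p ≟ r̂ ×-dec q ≟ c)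
  ... | yes source | _         = ⊥-elim (¬source source)
  ... | no _       | yes target = ⊥-elim (¬target target)
  ... | no _       | no _       = refl

  move : GhostMove x R afterMove
  move = record
    { MoveSite s
    ; newGhost = movedCell-source ; newOrd = movedCell-target ; unchanged = movedCell-elsewhere }

emptyIndicator : Cell → ℕ
emptyIndicator empty    = 1
emptyIndicator ordinary = 0
emptyIndicator ghost    = 0

emptyCount : Diagram → ℕ → ℕ
emptyCount x N = ∑< N λ r → ∑< N λ c → emptyIndicator (cell x r c)

module _ {y R F} (g : GhostMove y R F) where
  open GhostMove g

  emptyIndicator-nonincreasing : ∀ p q → emptyIndicator (cell F p q) ≤ emptyIndicator (cell y p q)
  emptyIndicator-nonincreasing p q with cellChange g p q
  ... | vacated refl refl rewrite newGhost = z≤n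
  ... | filled refl refl  rewrite newOrd   = z≤n
  ... | untouched e       rewrite e        = ≤-refl

  emptyCount-decreasing : ∀ {N} → Bounds y N → emptyCount F N < emptyCount y N
  emptyCount-decreasing {N} bnd =
    ∑<-mono-< N (λ p → ∑<-mono-≤ N (emptyIndicator-nonincreasing p)) (<-trans r̂<r R<N)
      (∑<-mono-< N (emptyIndicator-nonincreasing r̂) c<N gap-filled)
    where
    R<N : R < N
    R<N = proj₁ (ordinary-bounded y bnd isOrd)
    c<N : c < N
    c<N = proj₂ (ordinary-bounded y bnd isOrd)
    gap-filled : emptyIndicator (cell F r̂ c) < emptyIndicator (cell y r̂ c)
    gap-filled rewrite newOrd | r̂empty = s≤s z≤n

-- The conditions of MoveSite with every quantifier bounded by N, so that they are decidable.
EnabledWithin : Diagram → ℕ → ℕ → ℕ → ℕ → Set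
EnabledWithin x N R c r̂ =
  cell x R c ≡ ordinary × (∀ {c'} → c' < N → c < c' → cell x R c' ≡ empty) ×
  1 ≤ r̂ × cell x r̂ c ≡ empty ×
  (∀ {r'} → r' < R → r̂ < r' → cell x r' c ≢ empty) ×
  (∀ {r'} → r' < R → r̂ < r' → cell x r' c ≢ ghost)

enabledWithin? : ∀ x N R c r̂ → Dec (EnabledWithin x N R c r̂)
enabledWithin? x N R c r̂ =
  cell x R c ≟ᶜ ordinary ×-dec
  allUpTo? (λ c' → c <? c' →-dec cell x R c' ≟ᶜ empty) N ×-dec
  1 ≤? r̂ ×-dec cell x r̂ c ≟ᶜ empty ×-dec
  allUpTo? (λ r' → r̂ <? r' →-dec ¬? (cell x r' c ≟ᶜ empty)) R ×-dec
  allUpTo? (λ r' → r̂ <? r' →-dec ¬? (cell x r' c ≟ᶜ ghost)) R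

moveSite? : ∀ x → Dec (∃ (MoveSite x))
moveSite? x with finite x
... | N , bnd
  with anyUpTo? (λ R → anyUpTo? (λ c → anyUpTo? (λ r̂ → enabledWithin? x N R c r̂) R) N) N
... | yes (R , _ , c , _ , r̂ , r̂<R , isOrd , rightmost , r̂pos , r̂empty , r̂maximal , noGhost) =
  yes (R , record
    { c = c ; r̂ = r̂ ; isOrd = isOrd ; r̂pos = r̂pos ; r̂<r = r̂<R ; r̂empty = r̂empty
    ; rightmost = rowEmptyRightOf-bounded x R c bnd λ c'<N c<c' ne → ne (rightmost c'<N c<c')
    ; r̂maximal  = λ _ r̂<r' r'<R → r̂maximal r'<R r̂<r'
    ; noGhost   = λ _ r̂<r' r'<R → noGhost r'<R r̂<r' })
... | no disabled = no λ (R , s) →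
  let open MoveSite s in
  let R<N , c<N = ordinary-bounded x bnd isOrd in
  disabled (R , R<N , c , c<N , r̂ , r̂<r , isOrd , (λ _ → rightmost _) , r̂pos , r̂empty ,
            (λ r'<R r̂<r' → r̂maximal _ r̂<r' r'<R) , (λ r'<R r̂<r' → noGhost _ r̂<r' r'<R))

Stuck : Diagram → Set
Stuck x = ¬ ∃ (MoveSite x)

reach-stuck : ∀ {N} x → Bounds x N → Acc _<_ (emptyCount x N) → ∃ λ m → Reach x m × Stuck m
reach-stuck x bnd (acc smaller) with moveSite? x
... | no stuck = x , here (≈D-refl {x}) , stuck
... | yes (R , s) with reach-stuck (afterMove s) (movedCell-bounded s bnd)
                         (smaller (emptyCount-decreasing (move s) bnd))
... | m , s↠m , stuck = m , step R (move s) s↠m , stuck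

stuck⇒minimal : ∀ {D m} → GKD D m → Stuck m → IsMinimal D m
stuck⇒minimal {D} {m} D↠m stuck = D↠m , minimal
  where
  minimal : ∀ y → GKD D y → y ≼ m → y ≈D m
  minimal _ _ (here m≈y)   r c = sym (m≈y r c)
  minimal _ _ (step R g _) = ⊥-elim (stuck (R , siteOf g))

reach-minimal : ∀ {D x} → GKD D x → ∃ λ m → Reach x m × IsMinimal D m
reach-minimal {x = x} D↠x with finite x
... | N , bnd with reach-stuck x bnd (<-wellFounded _)
... | m , x↠m , stuck = m , x↠m , stuck⇒minimal (Reach-trans D↠x x↠m) stuck

record DownClosed (P : Diagram → Set) : Set where
  field
    resp-≈D : ∀ {y z} → y ≈D z → P y → P z
    stable  : ∀ {y R F} → GhostMove y R F → P y → P F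

  reach-stable : ∀ {y z} → Reach y z → P y → P z
  reach-stable (here y≈z)     = resp-≈D y≈z
  reach-stable (step _ g F↠z) = reach-stable F↠z ∘ stable g

minimum : ∀ {D} → Bounded D → Diagram
minimum ((m , _) , _) = m

minimum-inherits : ∀ {D x P} (B : Bounded D) → DownClosed P → GKD D x → P x → P (minimum B)
minimum-inherits ((_ , _ , unique) , _) P↓ D↠x Px with reach-minimal D↠x
... | m , x↠m , minimal = resp-≈D (unique m minimal) (reach-stable x↠m Px)
  where open DownClosed P↓

GhostAt : ℕ → ℕ → Diagram → Set
GhostAt a c y = cell y a c ≡ ghost

ghostAt-stable : ∀ {y R F a c} → GhostMove y R F → GhostAt a c y → GhostAt a c F
ghostAt-stable {a = a} {c} g ghostAt with cellChange g a c
... | vacated refl refl = ⊥-elim (ordinary≢ghost (trans (sym (GhostMove.isOrd g)) ghostAt))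
... | filled refl refl  = ⊥-elim (ghost≢empty (trans (sym ghostAt) (GhostMove.r̂empty g)))
... | untouched e       = trans e ghostAt

ghostAt-downClosed : ∀ {a c} → DownClosed (GhostAt a c)
ghostAt-downClosed {a} {c} = record
  { resp-≈D = λ y≈z → trans (sym (y≈z a c)) ; stable = ghostAt-stable }

RightShielded : ℕ → ℕ → ℕ → Diagram → Set
RightShielded a ca cb y = cell y a ca ≢ ghost × cell y a cb ≢ empty

rightNeighbour-protects : ∀ {y R F a ca cb} → ca < cb → GhostMove y R F →
  RightShielded a ca cb y → cell F a ca ≢ ghost
rightNeighbour-protects {a = a} {ca} ca<cb g (notGhost , occupied) with cellChange g a ca
... | vacated refl refl = ⊥-elim (occupied (GhostMove.rightmost g _ ca<cb))
... | filled refl refl  = ordinary≢ghost ∘ trans (sym (GhostMove.newOrd g))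
... | untouched e       = notGhost ∘ trans (sym e)

rightShielded-downClosed : ∀ {a ca cb} → ca < cb → DownClosed (RightShielded a ca cb)
rightShielded-downClosed {a} {ca} {cb} ca<cb = record
  { resp-≈D = λ y≈z (notGhost , occupied) →
      notGhost ∘ trans (y≈z a ca) , occupied ∘ trans (y≈z a cb)
  ; stable  = λ g shielded →
      rightNeighbour-protects ca<cb g shielded , nonEmpty-stable g (proj₂ shielded) }

ghostMove-cannotPass : ∀ {y R F a} (g : GhostMove y R F) → a < R →
  GhostAt a (GhostMove.c g) y → (∀ i → a < i → i < R → cell y i (GhostMove.c g) ≢ empty) → ⊥
ghostMove-cannotPass {a = a} g a<R ghostA occupied with <-cmp (GhostMove.r̂ g) a
... | tri< r̂<a _ _  = GhostMove.noGhost g a r̂<a a<R ghostA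
... | tri≈ _ refl _ = ghost≢empty (trans (sym ghostA) (GhostMove.r̂empty g))
... | tri> _ _ a<r̂  = occupied _ a<r̂ (GhostMove.r̂<r g) (GhostMove.r̂empty g)

GhostShielded : ℕ → ℕ → ℕ → Diagram → Set
GhostShielded a b c y =
  GhostAt a c y × cell y b c ≢ ghost × (∀ i → a < i → i < b → cell y i c ≢ empty)

ghostBelow-protects : ∀ {y R F a b c} → a < b → GhostMove y R F →
  GhostShielded a b c y → cell F b c ≢ ghost
ghostBelow-protects {b = b} {c} a<b g (ghostA , notGhost , between) with cellChange g b c
... | vacated refl refl = ⊥-elim (ghostMove-cannotPass g a<b ghostA between)
... | filled refl refl  = ordinary≢ghost ∘ trans (sym (GhostMove.newOrd g))
... | untouched e       = notGhost ∘ trans (sym e)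

ghostShielded-downClosed : ∀ {a b c} → a < b → DownClosed (GhostShielded a b c)
ghostShielded-downClosed {a} {b} {c} a<b = record
  { resp-≈D = λ y≈z (ghostA , notGhost , between) →
      trans (sym (y≈z a c)) ghostA , notGhost ∘ trans (y≈z b c) ,
      λ i a<i i<b → between i a<i i<b ∘ trans (y≈z i c)
  ; stable  = λ g shielded@(ghostA , _ , between) →
      ghostAt-stable g ghostA , ghostBelow-protects a<b g shielded ,
      λ i a<i i<b → nonEmpty-stable g (between i a<i i<b) }

NoGhostsUpTo : Diagram → ℕ → Set
NoGhostsUpTo x b = ∀ r c → r ≤ b → cell x r c ≢ ghost

noGhostsUpTo-mono : ∀ {x r s} → r ≤ s → NoGhostsUpTo x s → NoGhostsUpTo x r
noGhostsUpTo-mono r≤s noGhosts p q p≤r = noGhosts p q (≤-trans p≤r r≤s)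

noGhostsUpTo-stable : ∀ {x R F r} → GhostMove x R F → r < R → NoGhostsUpTo x r → NoGhostsUpTo F r
noGhostsUpTo-stable g r<R noGhosts p q p≤r with cellChange g p q
... | vacated refl refl = ⊥-elim (<⇒≱ r<R p≤r)
... | filled refl refl  = ordinary≢ghost ∘ trans (sym (GhostMove.newOrd g))
... | untouched e       = noGhosts p q p≤r ∘ trans (sym e)

freeSite : ∀ {x r c} → NoGhostsUpTo x r → FreeCell x r c → MoveSite x r
freeSite {x} {r} {c} noGhosts (isOrd , rightmost , below) = record
  { c = c ; r̂ = index ; isOrd = isOrd ; rightmost = rightmost
  ; r̂pos = proj₁ holds ; r̂<r = index<n ; r̂empty = proj₂ holds
  ; r̂maximal = λ r' index<r' r'<r r'-empty →
      maximal index<r' r'<r (≤-trans (proj₁ holds) (<⇒≤ index<r') , r'-empty)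
  ; noGhost = λ r* _ r*<r → noGhosts r* c (<⇒≤ r*<r) }
  where open Greatest (highestEmptyBelow {x} {r} {c} below)

freeCell-emptyBelow-above : ∀ {x a ca cb h} →
  FreeCell x a ca → ca ≤ cb → a < h → EmptyBelow x h cb
freeCell-emptyBelow-above (_ , rightmost , e , 1≤e , e<a , e-empty) ca≤cb a<h
  with m≤n⇒m<n∨m≡n ca≤cb
... | inj₁ ca<cb = _ , ≤-trans 1≤e (<⇒≤ e<a) , a<h , rightmost _ ca<cb
... | inj₂ refl  = e , 1≤e , <-trans e<a a<h , e-empty

module _ {x R F} (g : GhostMove x R F) where
  open GhostMove g

  freeCell-below-stable : ∀ {a c'} → a < r̂ → FreeCell x a c' → FreeCell F a c'
  freeCell-below-stable a<r̂ (ord , emptyRight , e , 1≤e , e<a , e-empty) =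
    trans (unchanged-below g _ a<r̂) ord ,
    (λ c'' lt → trans (unchanged-below g c'' a<r̂) (emptyRight c'' lt)) ,
    e , 1≤e , e<a , trans (unchanged-below g _ (<-trans e<a a<r̂)) e-empty

  freeCell-filled : RowEmptyRightOf x r̂ c → EmptyBelow x r̂ c → FreeCell F r̂ c
  freeCell-filled rowEmpty (e , 1≤e , e<r̂ , e-empty) =
    newOrd ,
    (λ c' c<c' → trans (unchanged-column g r̂ (>⇒≢ c<c')) (rowEmpty c' c<c')) ,
    e , 1≤e , e<r̂ , trans (unchanged-below g c e<r̂) e-empty

module _ {D : Diagram} (B : Bounded D) where

  FreePairsDescend : ℕ → Set
  FreePairsDescend b = ∀ {x a ca cb} → GKD D x → NoGhostsUpTo x b →
    FreeCell x a ca → FreeCell x b cb → a < b → ca ≤ cb → ⊥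

  sameColumn-jumpOver⇒⊥ : ∀ {x a b Y X} → GKD D x →
    (gY : GhostMove x a Y) (gX : GhostMove x b X) →
    a < b → GhostMove.c gY ≡ GhostMove.c gX → GhostMove.r̂ gX < a → ⊥
  sameColumn-jumpOver⇒⊥ {x} {a} {b} {Y} D↠x gY gX a<b sameColumn r̂X<a =
    proj₁ (proj₂ (minimum-inherits B (ghostShielded-downClosed a<b) (GKD-step D↠x gY) shieldedY))
          (minimum-inherits B ghostAt-downClosed (GKD-step D↠x gX) (GhostMove.newGhost gX))
    where
    c : ℕ
    c = GhostMove.c gX
    shieldedY : GhostShielded a b c Y
    shieldedY =
      subst (λ c' → GhostAt a c' Y) sameColumn (GhostMove.newGhost gY) ,
      ordinary≢ghost ∘ trans (sym (trans (unchanged-above gY c a<b) (GhostMove.isOrd gX))) ,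
      λ i a<i i<b → GhostMove.r̂maximal gX i (<-trans r̂X<a a<i) i<b
                      ∘ trans (sym (unchanged-above gY c a<i))

  rightColumn-landBeside⇒⊥ : ∀ {x a b Y X} → GKD D x →
    (gY : GhostMove x a Y) (gX : GhostMove x b X) →
    GhostMove.c gY < GhostMove.c gX → GhostMove.r̂ gX ≡ a → ⊥
  rightColumn-landBeside⇒⊥ {x} {a} {X = X} D↠x gY gX cY<cX r̂X≡a =
    proj₁ (minimum-inherits B (rightShielded-downClosed cY<cX) (GKD-step D↠x gX) shieldedX)
          (minimum-inherits B ghostAt-downClosed (GKD-step D↠x gY) (GhostMove.newGhost gY))
    where
    shieldedX : RightShielded a (GhostMove.c gY) (GhostMove.c gX) X
    shieldedX =
      ordinary≢ghost ∘ trans (sym (trans (unchanged-column gX a (<⇒≢ cY<cX)) (GhostMove.isOrd gY))) ,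
      ordinary≢empty ∘
        trans (sym (subst (λ r → cell X r (GhostMove.c gX) ≡ ordinary) r̂X≡a (GhostMove.newOrd gX)))

  descendToGapRow : ∀ {x a ca b X} (gX : GhostMove x b X) → FreePairsDescend (GhostMove.r̂ gX) →
    GKD D x → NoGhostsUpTo x (GhostMove.r̂ gX) → FreeCell x a ca → a < GhostMove.r̂ gX →
    ca ≤ GhostMove.c gX → EmptyBelow x (GhostMove.r̂ gX) (GhostMove.c gX) → ⊥
  descendToGapRow {x} gX ih D↠x noGhosts freeA a<r̂ ca≤c below
    with lastCellRightOf x (GhostMove.r̂ gX) (GhostMove.c gX)
  ... | inj₁ rowEmpty =
    ih (GKD-step D↠x gX) (noGhostsUpTo-stable gX (GhostMove.r̂<r gX) noGhosts)
       (freeCell-below-stable gX a<r̂ freeA) (freeCell-filled gX rowEmpty below) a<r̂ ca≤c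
  ... | inj₂ (c' , c<c' , occupied , rowEmpty) = ih D↠x noGhosts freeA freeR̂ a<r̂ ca≤c'
    where
    open GhostMove gX
    ca≤c' : _ ≤ c'
    ca≤c' = ≤-trans ca≤c (<⇒≤ c<c')
    freeR̂ : FreeCell x r̂ c'
    freeR̂ = ≢empty∧≢ghost⇒≡ordinary occupied (noGhosts r̂ c' ≤-refl) , rowEmpty ,
            freeCell-emptyBelow-above {x} freeA ca≤c' a<r̂

  freePairsDescend-step : ∀ {b} → (∀ {h} → h < b → FreePairsDescend h) → FreePairsDescend b
  freePairsDescend-step ih {x} {a} {ca} {cb} D↠x noGhosts freeA freeB a<b ca≤cb =
    compare (<-cmp h a) (m≤n⇒m<n∨m≡n ca≤cb)
    where
    siteY : MoveSite x a
    siteY = freeSite (noGhostsUpTo-mono {x} (<⇒≤ a<b) noGhosts) freeA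
    siteX : MoveSite x _
    siteX = freeSite noGhosts freeB
    gY : GhostMove x a (afterMove siteY)
    gY = move siteY
    gX : GhostMove x _ (afterMove siteX)
    gX = move siteX
    open GhostMove gX using () renaming (r̂ to h; r̂<r to h<b; r̂empty to h-empty; r̂maximal to h-maximal)

    compare : Tri (h < a) (h ≡ a) (a < h) → ca < cb ⊎ ca ≡ cb → ⊥
    compare (tri< h<a _ _) (inj₁ ca<cb) = h-maximal a h<a a<b (proj₁ (proj₂ freeA) cb ca<cb)
    compare (tri< h<a _ _) (inj₂ ca≡cb) = sameColumn-jumpOver⇒⊥ D↠x gY gX a<b ca≡cb h<a
    compare (tri≈ _ h≡a _) (inj₁ ca<cb) = rightColumn-landBeside⇒⊥ D↠x gY gX ca<cb h≡a
    compare (tri≈ _ h≡a _) (inj₂ ca≡cb) =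
      ordinary≢empty
        (trans (sym (proj₁ freeA)) (subst₂ (λ r c → cell x r c ≡ empty) h≡a (sym ca≡cb) h-empty))
    compare (tri> _ _ a<h) _ =
      descendToGapRow gX (ih h<b) D↠x (noGhostsUpTo-mono {x} (<⇒≤ h<b) noGhosts) freeA a<h ca≤cb
        (freeCell-emptyBelow-above {x} freeA ca≤cb a<h)

  freePairsDescend : ∀ b → FreePairsDescend b
  freePairsDescend = <-rec FreePairsDescend (λ _ → freePairsDescend-step)

corollary3p14 : (D : Diagram) → NoGhosts D → Bounded D →
    (∀ r c r' → FreeCell D r c → FreeCell D r' c → r ≡ r') ×
    (∀ r c r' c' → FreeCell D r c → FreeCell D r' c' → c < c' → r' < r)
corollary3p14 D noGhosts B = sameRow , descending
  where
  descend : ∀ {a ca b cb} → FreeCell D a ca → FreeCell D b cb → a < b → cb < ca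
  descend freeA freeB a<b =
    ≰⇒> (freePairsDescend B _ {D} (here (≈D-refl {D})) (λ r c _ → noGhosts r c) freeA freeB a<b)

  sameRow : ∀ r c r' → FreeCell D r c → FreeCell D r' c → r ≡ r'
  sameRow r c r' free free' = ≤-antisym (≮⇒≥ (<-irrefl refl ∘ descend free' free))
                                        (≮⇒≥ (<-irrefl refl ∘ descend free free'))

  descending : ∀ r c r' c' → FreeCell D r c → FreeCell D r' c' → c < c' → r' < r
  descending r c r' c' free free' c<c' with <-cmp r' r
  ... | tri< r'<r _ _ = r'<r
  ... | tri≈ _ refl _ =
    ⊥-elim (ordinary≢empty (trans (sym (proj₁ free')) (proj₁ (proj₂ free) c' c<c')))
  ... | tri> _ _ r<r' = ⊥-elim (<-asym c<c' (descend free free' r<r'))
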